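{- Let $X$ be a finite nonempty linearly ordered set, let $C$ be a simplicial complex with $\bigcup C=X$, and let $B$ be a building set of $C$. Then $\kappa_X$ faithfully realizes both $C$ and $\mathrm{St}_X(C,B)$, and $\bigcup\kappa_X(\mathrm{St}_X(C,B))\subseteq\bigcup\kappa_X(C)$.
   Context: A simplicial complex is a set $C=P(\alpha_1)\cup\ldots\cup P(\alpha_m)$, $m\ge1$, with $P(\cdot)$ the power set and the $\alpha_i$ finite pairwise $\subseteq$-incomparable sets (bases). For a family $B$ and a set $\beta$, $B_\beta=B\cap P(\beta)$. A building set of $P(\gamma)$ ($\gamma$ finite) is a set $B$ of nonempty subsets of $\gamma$ with (B1) $\beta,\delta\in B$, $\beta\cap\delta\ne\emptyset$ imply $\beta\cup\delta\in B$, (B2) $\{a\}\in B$ for $a\in\gamma$. A building set of $C$ with bases $\alpha_i$ is $B\subseteq C$ with every $B_{\alpha_i}$ a building set of $P(\alpha_i)$. An $N$-antichain is a set of at least two pairwise $\subseteq$-incomparable members of $N$. $N\subseteq B$ is nested if for every $N$-antichain $\{\beta_1,\ldots,\beta_t\}$, $\beta_1\cup\ldots\cup\beta_t\in C-B$; $\widetilde{\mathcal N}(C,B)$ is the simplicial complex of nested subsets of $B$. $TX$ is the free commutative semigroup generated by $X$ (formal sums $k_1x_1+\ldots+k_rx_r$, $r\ge1$, distinct $x_j$, positive integers $k_j$; $x$ identified with $1x$). $\sigma_X$ maps a finite nonempty set $\{a_1,\ldots,a_k\}\subseteq X$ (distinct $a_j$) to $a_1+\ldots+a_k$, and $\mathrm{St}_X(C,B)=\{\{\sigma_X(\beta)\mid\beta\in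 N\}\mid N\in\widetilde{\mathcal N}(C,B)\}$. If $X=\{x_1<\ldots<x_d\}$, $\kappa_X:TX\to\mathbb R^d$ sends $\sum_jk_jx_j$ to $(k_1,\ldots,k_d)$. A function $f$ with values in $\mathbb R^d$ defined on $\bigcup D$ faithfully realizes a simplicial complex $D$ if for all $\alpha,\beta\in D$ and positive reals $k_a,l_b$, $\sum_{a\in\alpha}k_af(a)=\sum_{b\in\beta}l_bf(b)$ implies $\alpha=\beta$ and $k_a=l_a$ for all $a\in\alpha$. $f(D)=\{\mathrm{cone}(\{f(a)\mid a\in\alpha\})\mid\alpha\in D\}$, where $\mathrm{cone}(S)$ is the set of nonnegative linear combinations of $S$ ($\mathrm{cone}(\emptyset)=\{0\}$). -}

module Defs where

open import Level using (0ℓ)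
open import Data.Nat using (ℕ; zero; suc; _≥_)
open import Data.Fin using (Fin)
open import Data.Fin.Subset as S using (Subset; ⁅_⁆; _∪_; _∩_; Nonempty)
open import Data.Bool using (Bool; true; false)
open import Data.Vec using (Vec; lookup)
import Data.Vec as V
open import Data.List using (List; []; _∷_; foldr; length)
import Data.List as L
open import Data.List.Relation.Unary.All using (All)
open import Data.List.Relation.Unary.Any using (Any)
open import Data.List.Relation.Unary.AllPairs using (AllPairs)
open import Data.List.Relation.Unary.Unique.Propositional using (Unique)
open import Data.List.Membership.Propositional renaming (_∈_ to _∈ₗ_)
open import Data.Product using (Σ; _×_; _,_)
open import Data.Sum using (_⊎_)
open import Relation.Nullary using (¬_)
open import Relation.Binary.PropositionalEquality using (_≡_)
open import Function.Bundles using (_⇔_)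

-- The real numbers, axiomatised as a complete ordered field
-- (any two models are isomorphic; the theorem quantifies over a model).

record Reals : Set₁ where
  infixl 6 _+_
  infixl 7 _*_
  infix 4 _<_ _≤_
  field
    ℝ : Set
    0# 1# : ℝ
    _+_ _*_ : ℝ → ℝ → ℝ
    -_ : ℝ → ℝ
    _<_ : ℝ → ℝ → Set
    +-assoc : ∀ x y z → (x + y) + z ≡ x + (y + z)
    +-comm : ∀ x y → x + y ≡ y + x
    +-identityˡ : ∀ x → 0# + x ≡ x
    +-inverseˡ : ∀ x → (- x) + x ≡ 0#
    *-assoc : ∀ x y z → (x * y) * z ≡ x * (y * z)
    *-comm : ∀ x y → x * y ≡ y * x
    *-identityˡ : ∀ x → 1# * x ≡ x
    distribˡ : ∀ x y z → x * (y + z) ≡ x * y + x * z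
    0≢1 : ¬ (0# ≡ 1#)
    *-inverse : ∀ x → ¬ (x ≡ 0#) → Σ ℝ (λ y → y * x ≡ 1#)
    <-irrefl : ∀ x → ¬ (x < x)
    <-trans : ∀ x y z → x < y → y < z → x < z
    <-trichotomy : ∀ x y → x < y ⊎ (x ≡ y ⊎ y < x)
    +-mono-< : ∀ x y z → x < y → x + z < y + z
    *-pos : ∀ x y → 0# < x → 0# < y → 0# < x * y

  _≤_ : ℝ → ℝ → Set
  x ≤ y = x < y ⊎ x ≡ y

  field
    complete : (P : ℝ → Set) → Σ ℝ P → Σ ℝ (λ b → ∀ x → P x → x ≤ b) →
               Σ ℝ (λ s → (∀ x → P x → x ≤ s) ×
                          (∀ b → (∀ x → P x → x ≤ b) → s ≤ b))

Incomparable : ∀ {d} → Subset d → Subset d → Set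
Incomparable β δ = ¬ (β S.⊆ δ) × ¬ (δ S.⊆ β)

-- C = P(α₁) ∪ … ∪ P(αₘ), given by its list of bases
record SimplicialComplex (d : ℕ) : Set where
  field
    bases : List (Subset d)
    nonemptyBases : length bases ≥ 1
    incomparable : AllPairs Incomparable bases

_∈C_ : ∀ {d} → Subset d → SimplicialComplex d → Set
β ∈C C = Any (β S.⊆_) (SimplicialComplex.bases C)

CoversX : ∀ {d} → SimplicialComplex d → Set
CoversX {d} C = ∀ (x : Fin d) → Any (x S.∈_) (SimplicialComplex.bases C)

IsBuildingSetOfPowerSet : ∀ {d} → (Subset d → Set) → Subset d → Set
IsBuildingSetOfPowerSet B α =
    (∀ β → B β → β S.⊆ α → Nonempty β)
  × (∀ β δ → B β → β S.⊆ α → B δ → δ S.⊆ α → Nonempty (β ∩ δ) → B (β ∪ δ))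
  × (∀ a → a S.∈ α → B ⁅ a ⁆)

IsBuildingSet : ∀ {d} → SimplicialComplex d → (Subset d → Set) → Set
IsBuildingSet C B =
    (∀ β → B β → β ∈C C)
  × All (IsBuildingSetOfPowerSet B) (SimplicialComplex.bases C)

⋃ : ∀ {d} → List (Subset d) → Subset d
⋃ = foldr _∪_ S.⊥

IsAntichainOf : ∀ {d} → List (Subset d) → List (Subset d) → Set
IsAntichainOf N A = Unique A × length A ≥ 2 × All (_∈ₗ N) A × AllPairs Incomparable A

IsNested : ∀ {d} → SimplicialComplex d → (Subset d → Set) → List (Subset d) → Set
IsNested C B N =
  Unique N × All B N ×
  (∀ A → IsAntichainOf N A → (⋃ A ∈C C) × ¬ B (⋃ A))

-- TX for X = Fin d: the formal sum Σ kⱼ xⱼ is represented by its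
-- coefficient vector (k₁,…,k_d) ∈ ℕ^d (elements of TX are the nonzero ones).

TX : ℕ → Set
TX d = Vec ℕ d

ιX : ∀ {d} → Fin d → TX d
ιX {d} x = V.tabulate (λ j → indicator (x Data.Fin.≟ j))
  where
  open import Relation.Nullary using (yes; no)
  indicator : ∀ {P : Set} → Relation.Nullary.Dec P → ℕ
  indicator (yes _) = 1
  indicator (no _) = 0

σX : ∀ {d} → Subset d → TX d
σX = V.map (λ { true → 1 ; false → 0 })

InSt : ∀ {d} → SimplicialComplex d → (Subset d → Set) → List (TX d) → Set
InSt C B γ = Σ (List _) (λ N → IsNested C B N × γ ≡ L.map σX N)

InCList : ∀ {d} → SimplicialComplex d → List (Fin d) → Set
InCList C α = Any (λ base → All (S._∈ base) α) (SimplicialComplex.bases C)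

module Geometry (R : Reals) where
  open Reals R

  Vecℝ : ℕ → Set
  Vecℝ d = Fin d → ℝ

  fromℕ : ℕ → ℝ
  fromℕ zero = 0#
  fromℕ (suc n) = 1# + fromℕ n

  κX : ∀ {d} → TX d → Vecℝ d
  κX t i = fromℕ (lookup t i)

  lincomb : ∀ {V : Set} {d} → (V → Vecℝ d) → (V → ℝ) → List V → Vecℝ d
  lincomb f k [] i = 0#
  lincomb f k (a ∷ α) i = k a * f a i + lincomb f k α i

  _≈_ : ∀ {d} → Vecℝ d → Vecℝ d → Set
  u ≈ v = ∀ i → u i ≡ v i

  FaithfullyRealizes : ∀ {V : Set} {d} → (V → Vecℝ d) → (List V → Set) → Set
  FaithfullyRealizes {V} f D =
    ∀ α β → Unique α → Unique β → D α → D β →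
    (k l : V → ℝ) → All (λ a → 0# < k a) α → All (λ b → 0# < l b) β →
    lincomb f k α ≈ lincomb f l β →
    (∀ v → (v ∈ₗ α) ⇔ (v ∈ₗ β)) × All (λ a → k a ≡ l a) α

  InCone : ∀ {V : Set} {d} → (V → Vecℝ d) → List V → Vecℝ d → Set
  InCone {V} f α v = Σ (V → ℝ) (λ k → All (λ a → 0# ≤ k a) α × v ≈ lincomb f k α)

  InUnionImage : ∀ {V : Set} {d} → (V → Vecℝ d) → (List V → Set) → Vecℝ d → Set
  InUnionImage {V} f D v = Σ (List V) (λ α → Unique α × D α × InCone f α v)

-- κX sends the vertices of C to the standard basis vectors, which realize any family of faces faithfully,
-- and it sends σX β to the indicator vector of β. Two positive combinations of the indicator vectors of
-- nested sets N, N' that agree have the same support ⋃ N = ⋃ N', hence the same maximal members: a member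
-- of B covered by a nested set lies in one of its members, since otherwise the maximal members meeting it
-- would form an antichain whose union lies in B. A maximal member β has a point lying in no other member of
-- its nested set; reading the two combinations there shows that each coefficient of β dominates the other,
-- so they agree, and β can be removed from both sides. Finally ⋃ N is a face of C, so the cone over a face
-- of St lies in the coordinate cone spanned by the vertices of ⋃ N.

module Submission where

open import Defs
open import Data.Nat using (ℕ; suc; _∸_; s≤s; z≤n)
import Data.Nat as ℕ
open import Data.Nat.Properties using (∸-monoʳ-<; suc-injective)
open import Data.Nat.Induction using (<-wellFounded)
open import Induction.WellFounded using (Acc; acc)
open import Data.Bool using (true; false)
import Data.Bool as Bool
open import Data.Fin using (Fin; zero; suc) renaming (_≟_ to _≟ᶠ_)
open import Data.Fin.Properties using (¬∀⟶∃¬)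
open import Data.Fin.Subset as S using (Subset; _∈_; _∉_; _⊆_; _⊂_; _∪_; _∩_; Nonempty; ∣_∣)
open import Data.Fin.Subset.Properties
  using (_∈?_; _⊆?_; nonempty?; ∉⊥; ⊥⊆; ⊆-trans; ⊆-antisym; x∈p∪q⁻; x∈p∪q⁺; p⊆p∪q; x∈p∩q⁺; x∈p∩q⁻;
         ∪-assoc; ∪-identityʳ; ∣p∣≤n; p⊂q⇒∣p∣<∣q∣)
open import Data.Vec using (_∷_; lookup)
import Data.Vec as Vec
import Data.Vec.Properties as Vecₚ
open import Data.List using (List; []; _∷_; _++_; length; map; filter; allFin)
open import Data.List.Relation.Unary.All as All using (All; []; _∷_)
import Data.List.Relation.Unary.All.Properties as Allₚ
open import Data.List.Relation.Unary.Any as Any using (Any; here; there)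
open import Data.List.Relation.Unary.AllPairs using (AllPairs; []; _∷_)
import Data.List.Relation.Unary.AllPairs.Properties as AllPairsₚ
open import Data.List.Relation.Unary.Unique.Propositional using (Unique)
import Data.List.Relation.Unary.Unique.Propositional.Properties as Uniqueₚ
open import Data.List.Membership.Propositional using (find) renaming (_∈_ to _∈ₗ_; _∉_ to _∉ₗ_)
open import Data.List.Membership.Propositional.Properties
  using (∈-filter⁺; ∈-filter⁻; ∈-∃++; ∈-map⁺; ∈-map⁻; ∈-allFin)
import Data.List.Membership.DecPropositional as DecMembership
open import Data.List.Relation.Binary.Permutation.Propositional using (_↭_; ↭-sym; ↭⇒↭ₛ)
open import Data.List.Relation.Binary.Permutation.Propositional.Properties
  using (All-resp-↭; ∈-resp-↭; ↭-length; shift)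
import Data.List.Relation.Binary.Permutation.Setoid.Properties as ↭ₛ
open import Data.Product using (Σ; ∃-syntax; _×_; _,_; proj₁; proj₂; map₂)
open import Data.Sum using (inj₁; inj₂; [_,_]′)
open import Data.Empty using (⊥; ⊥-elim)
open import Relation.Nullary using (¬_; Dec; yes; no; contradiction)
open import Relation.Nullary.Decidable using (_→-dec_; decidable-stable)
open import Relation.Unary using (Decidable)
open import Relation.Binary.PropositionalEquality
open import Function using (_∘_; id)
open import Function.Bundles using (_⇔_; mk⇔; Equivalence)

AllPairs-strengthen : ∀ {A : Set} {P : A → Set} {R S : A → A → Set} →
                      (∀ {x y} → P x → P y → R x y → S x y) →
                      ∀ {xs} → All P xs → AllPairs R xs → AllPairs S xs
AllPairs-strengthen f [] [] = []
AllPairs-strengthen f (px ∷ pxs) (rxs ∷ rs) =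
  All.zipWith (λ (py , rxy) → f px py rxy) (pxs , rxs) ∷ AllPairs-strengthen f pxs rs

Unique-resp-↭ : ∀ {A : Set} {xs ys : List A} → xs ↭ ys → Unique xs → Unique ys
Unique-resp-↭ {A} p = ↭ₛ.Unique-resp-↭ (setoid A) (↭⇒↭ₛ p)

∈⇒↭∷ : ∀ {A : Set} {x : A} {xs} → x ∈ₗ xs → ∃[ ys ] xs ↭ x ∷ ys
∈⇒↭∷ {x = x} x∈xs with ys , zs , refl ← ∈-∃++ x∈xs = ys ++ zs , shift x ys zs

module _ {d : ℕ} where

  ⋃⁺ : ∀ {L : List (Subset d)} {δ x} → δ ∈ₗ L → x ∈ δ → x ∈ ⋃ L
  ⋃⁺ (here refl) x∈δ = x∈p∪q⁺ (inj₁ x∈δ)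
  ⋃⁺ (there δ∈L) x∈δ = x∈p∪q⁺ (inj₂ (⋃⁺ δ∈L x∈δ))

  ⋃⁻ : ∀ (L : List (Subset d)) {x} → x ∈ ⋃ L → ∃[ δ ] δ ∈ₗ L × x ∈ δ
  ⋃⁻ [] x∈⊥ = contradiction x∈⊥ ∉⊥
  ⋃⁻ (δ ∷ L) x∈⋃ with x∈p∪q⁻ δ (⋃ L) x∈⋃
  ... | inj₁ x∈δ = δ , here refl , x∈δ
  ... | inj₂ x∈⋃L with δ' , δ'∈L , x∈δ' ← ⋃⁻ L x∈⋃L = δ' , there δ'∈L , x∈δ'

  ∪-⊆ : ∀ {p q r : Subset d} → p ⊆ r → q ⊆ r → p ∪ q ⊆ r
  ∪-⊆ {p} {q} p⊆r q⊆r x∈p∪q = [ p⊆r , q⊆r ]′ (x∈p∪q⁻ p q x∈p∪q)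

  ⊈⇒∃∉ : ∀ {p q : Subset d} → ¬ p ⊆ q → ∃[ x ] x ∈ p × x ∉ q
  ⊈⇒∃∉ {p} {q} p⊈q
    with x , ¬[x∈p→x∈q] ← ¬∀⟶∃¬ d (λ x → x ∈ p → x ∈ q) (λ x → x ∈? p →-dec x ∈? q) (λ h → p⊈q (h _))
    = x , decidable-stable (x ∈? p) (λ x∉p → ¬[x∈p→x∈q] (λ x∈p → contradiction x∈p x∉p)) ,
      λ x∈q → ¬[x∈p→x∈q] (λ _ → x∈q)

  ⊆∧≢⇒⊂ : ∀ {p q : Subset d} → p ⊆ q → p ≢ q → p ⊂ q
  ⊆∧≢⇒⊂ p⊆q p≢q = p⊆q , ⊈⇒∃∉ (λ q⊆p → p≢q (⊆-antisym p⊆q q⊆p))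

  _≟ₛ_ : (p q : Subset d) → Dec (p ≡ q)
  _≟ₛ_ = Vecₚ.≡-dec Bool._≟_

  IsMaximal : List (Subset d) → Subset d → Set
  IsMaximal P β = All (λ δ → β ⊆ δ → δ ≡ β) P

  isMaximal? : ∀ P → Decidable (IsMaximal P)
  isMaximal? P β = All.all? (λ δ → β ⊆? δ →-dec δ ≟ₛ β) P

  maximals : List (Subset d) → List (Subset d)
  maximals P = filter (isMaximal? P) P

  ¬maximal⇒⊂ : ∀ {P β} → ¬ IsMaximal P β → ∃[ δ ] δ ∈ₗ P × β ⊂ δ
  ¬maximal⇒⊂ {P} {β} ¬max
    with δ , δ∈P , ¬[β⊆δ→δ≡β] ← find (Allₚ.¬All⇒Any¬ (λ δ → β ⊆? δ →-dec δ ≟ₛ β) P ¬max)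
    = δ , δ∈P , ⊆∧≢⇒⊂ β⊆δ (λ β≡δ → ¬[β⊆δ→δ≡β] (λ _ → sym β≡δ))
    where
    β⊆δ : β ⊆ δ
    β⊆δ = decidable-stable (β ⊆? δ) (λ β⊈δ → ¬[β⊆δ→δ≡β] (λ β⊆δ → contradiction (λ {x} → β⊆δ {x}) β⊈δ))

  -- Each step up a strict chain raises the cardinality, which is bounded by d.
  maximal-above : ∀ P {β} → β ∈ₗ P → ∃[ μ ] μ ∈ₗ maximals P × β ⊆ μ
  maximal-above P = climb (<-wellFounded _)
    where
    climb : ∀ {β} → Acc ℕ._<_ (d ∸ ∣ β ∣) → β ∈ₗ P → ∃[ μ ] μ ∈ₗ maximals P × β ⊆ μ
    climb {β} (acc smaller) β∈P with isMaximal? P β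
    ... | yes βmax = β , ∈-filter⁺ (isMaximal? P) β∈P βmax , id
    ... | no ¬βmax
      with δ , δ∈P , β⊂δ ← ¬maximal⇒⊂ ¬βmax
      with μ , μ∈max , δ⊆μ ← climb (smaller (∸-monoʳ-< (p⊂q⇒∣p∣<∣q∣ β⊂δ) (∣p∣≤n δ))) δ∈P
      = μ , μ∈max , ⊆-trans (proj₁ β⊂δ) δ⊆μ

  maximals-cover : ∀ P → ⋃ P ⊆ ⋃ (maximals P)
  maximals-cover P x∈⋃P
    with δ , δ∈P , x∈δ ← ⋃⁻ P x∈⋃P
    with μ , μ∈max , δ⊆μ ← maximal-above P δ∈P
    = ⋃⁺ μ∈max (δ⊆μ x∈δ)

  maximals-incomparable : ∀ {P} → Unique P → AllPairs Incomparable (maximals P)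
  maximals-incomparable {P} uP =
    AllPairs-strengthen incomparable (All.tabulate (∈-filter⁻ (isMaximal? P)))
                                     (Uniqueₚ.filter⁺ (isMaximal? P) uP)
    where
    incomparable : ∀ {β δ} → β ∈ₗ P × IsMaximal P β → δ ∈ₗ P × IsMaximal P δ → β ≢ δ → Incomparable β δ
    incomparable (β∈P , βmax) (δ∈P , δmax) β≢δ =
      (λ β⊆δ → β≢δ (sym (All.lookup βmax δ∈P β⊆δ))) , (λ δ⊆β → β≢δ (All.lookup δmax β∈P δ⊆β))

module NestedSets {d : ℕ} (C : SimplicialComplex d) (B : Subset d → Set) (building : IsBuildingSet C B)
  where
  open SimplicialComplex C

  Nested : List (Subset d) → Set
  Nested = IsNested C B

  Meets : Subset d → Subset d → Set
  Meets γ δ = Nonempty (γ ∩ δ)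

  Meets? : ∀ γ → Decidable (Meets γ)
  Meets? γ δ = nonempty? (γ ∩ δ)

  Meets-mono : ∀ {γ γ' δ} → γ ⊆ γ' → Meets γ δ → Meets γ' δ
  Meets-mono {γ} {δ = δ} γ⊆γ' (x , x∈γ∩δ) with x∈γ , x∈δ ← x∈p∩q⁻ γ δ x∈γ∩δ
    = x , x∈p∩q⁺ (γ⊆γ' x∈γ , x∈δ)

  ∈C-⊆ : ∀ {β γ} → β ⊆ γ → γ ∈C C → β ∈C C
  ∈C-⊆ β⊆γ = Any.map (⊆-trans β⊆γ)

  ∅∈C : S.⊥ ∈C C
  ∅∈C with bases | nonemptyBases
  ... | _ ∷ _ | _ = here ⊥⊆

  building-base : ∀ {β} → β ∈C C → ∃[ α ] IsBuildingSetOfPowerSet B α × β ⊆ α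
  building-base β∈C = Any.lookup β∈C , All.lookupAny (proj₂ building) β∈C

  building-nonempty : ∀ {β} → B β → Nonempty β
  building-nonempty {β} Bβ with _ , (nonempty , _) , β⊆α ← building-base (proj₁ building β Bβ)
    = nonempty β Bβ β⊆α

  ∪-⋃-closed : ∀ {α γ} → IsBuildingSetOfPowerSet B α → B γ → γ ⊆ α → ∀ L →
               All (λ δ → B δ × δ ⊆ α × Meets γ δ) L → B (γ ∪ ⋃ L)
  ∪-⋃-closed {γ = γ} _ Bγ _ [] [] = subst B (sym (∪-identityʳ γ)) Bγ
  ∪-⋃-closed {α} {γ} bα@(_ , unions , _) Bγ γ⊆α (δ ∷ L) ((Bδ , δ⊆α , γ∩δ) ∷ rest) =
    subst B (∪-assoc γ δ (⋃ L))
      (∪-⋃-closed bα (unions γ δ Bγ γ⊆α Bδ δ⊆α γ∩δ) (∪-⊆ γ⊆α δ⊆α) L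
        (All.map (map₂ (map₂ (Meets-mono (p⊆p∪q δ)))) rest))

  no-covering-antichain : ∀ {N A γ} → Nested N → IsAntichainOf N A → B γ → γ ⊆ ⋃ A → All (Meets γ) A → ⊥
  no-covering-antichain {N} {A} {γ} (_ , N⊆B , antichain) A-anti@(_ , _ , A⊆N , _) Bγ γ⊆⋃A γ-meets
    with ⋃A∈C , ⋃A∉B ← antichain A A-anti
    with α , bα , ⋃A⊆α ← building-base ⋃A∈C
    = ⋃A∉B (subst B γ∪⋃A≡⋃A (∪-⋃-closed bα Bγ (⊆-trans γ⊆⋃A ⋃A⊆α) A (All.tabulate member-facts)))
    where
    member-facts : ∀ {δ} → δ ∈ₗ A → B δ × δ ⊆ α × Meets γ δ
    member-facts δ∈A = All.lookup N⊆B (All.lookup A⊆N δ∈A) , ⊆-trans (⋃⁺ δ∈A) ⋃A⊆α , All.lookup γ-meets δ∈A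
    γ∪⋃A≡⋃A : γ ∪ ⋃ A ≡ ⋃ A
    γ∪⋃A≡⋃A = ⊆-antisym (∪-⊆ γ⊆⋃A id) (x∈p∪q⁺ ∘ inj₂)

  nested-⊆ : ∀ {N N'} → Nested N → Unique N' → (∀ {δ} → δ ∈ₗ N' → δ ∈ₗ N) → Nested N'
  nested-⊆ (_ , N⊆B , antichain) uN' N'⊆N =
    uN' , All.tabulate (All.lookup N⊆B ∘ N'⊆N) ,
    λ A (uA , |A|≥2 , A⊆N' , incomparable) → antichain A (uA , |A|≥2 , All.map N'⊆N A⊆N' , incomparable)

  nested-↭ : ∀ {N N'} → N ↭ N' → Nested N → Nested N'
  nested-↭ N↭N' nN = nested-⊆ nN (Unique-resp-↭ N↭N' (proj₁ nN)) (∈-resp-↭ (↭-sym N↭N'))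

  covered⇒below-member : ∀ {N P γ} → Nested N → Unique P → (∀ {δ} → δ ∈ₗ P → δ ∈ₗ N) → B γ → γ ⊆ ⋃ P →
                         ∃[ δ ] δ ∈ₗ P × γ ⊆ δ
  covered⇒below-member {N} {P} {γ} nN uP P⊆N Bγ γ⊆⋃P =
    single (filter (Meets? γ) (maximals P))
      (Uniqueₚ.filter⁺ (Meets? γ) (Uniqueₚ.filter⁺ (isMaximal? P) uP))
      (All.tabulate (proj₁ ∘ ∈-filter⁻ (isMaximal? P) ∘ proj₁ ∘ ∈-filter⁻ (Meets? γ)))
      (AllPairsₚ.filter⁺ (Meets? γ) (maximals-incomparable uP))
      (Allₚ.all-filter (Meets? γ) (maximals P))
      cover
    where
    cover : γ ⊆ ⋃ (filter (Meets? γ) (maximals P))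
    cover x∈γ with μ , μ∈max , x∈μ ← ⋃⁻ (maximals P) (maximals-cover P (γ⊆⋃P x∈γ))
      = ⋃⁺ (∈-filter⁺ (Meets? γ) μ∈max (_ , x∈p∩q⁺ (x∈γ , x∈μ))) x∈μ
    single : ∀ L → Unique L → All (_∈ₗ P) L → AllPairs Incomparable L → All (Meets γ) L → γ ⊆ ⋃ L →
             ∃[ δ ] δ ∈ₗ P × γ ⊆ δ
    single [] _ _ _ _ γ⊆⊥ with x , x∈γ ← building-nonempty Bγ = contradiction (γ⊆⊥ x∈γ) ∉⊥
    single (δ ∷ []) _ (δ∈P ∷ []) _ _ γ⊆δ∪⊥ = δ , δ∈P , subst (γ ⊆_) (∪-identityʳ δ) γ⊆δ∪⊥
    single L@(_ ∷ _ ∷ _) uL L⊆P incomparable γ-meets γ⊆⋃L =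
      ⊥-elim (no-covering-antichain nN (uL , s≤s (s≤s z≤n) , All.map P⊆N L⊆P , incomparable) Bγ γ⊆⋃L γ-meets)

  incomparable⇒disjoint : ∀ {N β δ} → Nested N → β ∈ₗ N → δ ∈ₗ N → Incomparable β δ → ¬ Meets β δ
  incomparable⇒disjoint {β = β} {δ} nN@(_ , N⊆B , _) β∈N δ∈N (β⊈δ , δ⊈β) (x , x∈β∩δ) =
    no-covering-antichain nN
      ((β≢δ ∷ []) ∷ [] ∷ [] , s≤s (s≤s z≤n) , β∈N ∷ δ∈N ∷ [] , ((β⊈δ , δ⊈β) ∷ []) ∷ [] ∷ [])
      (All.lookup N⊆B β∈N) (⋃⁺ {L = β ∷ δ ∷ []} (here refl)) ((x , x∈p∩q⁺ (x∈β , x∈β)) ∷ (x , x∈β∩δ) ∷ [])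
    where
    x∈β : x ∈ β
    x∈β = proj₁ (x∈p∩q⁻ β δ x∈β∩δ)
    β≢δ : β ≢ δ
    β≢δ refl = β⊈δ id

  -- The members of N below β cannot cover β, which leaves a point of β outside every other member.
  private-point : ∀ {β N} → Nested (β ∷ N) → IsMaximal N β → ∃[ y ] y ∈ β × y ∉ ⋃ N
  private-point {β} {N} nβN@(β∉N ∷ uN , Bβ ∷ _ , _) βmax with β ⊆? ⋃ (filter (_⊆? β) N)
  ... | yes β⊆⋃below
    with δ , δ∈below , β⊆δ ← covered⇒below-member nβN (Uniqueₚ.filter⁺ (_⊆? β) uN)
                                (there ∘ proj₁ ∘ ∈-filter⁻ (_⊆? β) {xs = N}) Bβ β⊆⋃below
    with δ∈N , δ⊆β ← ∈-filter⁻ (_⊆? β) δ∈below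
    = contradiction (⊆-antisym β⊆δ δ⊆β) (All.lookup β∉N δ∈N)
  ... | no β⊈⋃below with y , y∈β , y∉⋃below ← ⊈⇒∃∉ β⊈⋃below = y , y∈β , y∉⋃N
    where
    y∉⋃N : y ∉ ⋃ N
    y∉⋃N y∈⋃N
      with δ , δ∈N , y∈δ ← ⋃⁻ N y∈⋃N
      with δ ⊆? β | β ⊆? δ
    ... | yes δ⊆β | _ = y∉⋃below (⋃⁺ (∈-filter⁺ (_⊆? β) δ∈N δ⊆β) y∈δ)
    ... | no _ | yes β⊆δ = All.lookup β∉N δ∈N (sym (All.lookup βmax δ∈N β⊆δ))
    ... | no δ⊈β | no β⊈δ =
      incomparable⇒disjoint nβN (here refl) (there δ∈N) (β⊈δ , δ⊈β) (y , x∈p∩q⁺ (y∈β , y∈δ))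

  ⋃-nested-∈C : ∀ {N} → Nested N → ⋃ N ∈C C
  ⋃-nested-∈C {N} nN@(uN , N⊆B , antichain) =
    ∈C-⊆ (maximals-cover N)
      (union-∈C (maximals N) (Uniqueₚ.filter⁺ (isMaximal? N) uN)
        (All.tabulate (proj₁ ∘ ∈-filter⁻ (isMaximal? N))) (maximals-incomparable uN))
    where
    union-∈C : ∀ L → Unique L → All (_∈ₗ N) L → AllPairs Incomparable L → ⋃ L ∈C C
    union-∈C [] _ _ _ = ∅∈C
    union-∈C (δ ∷ []) _ (δ∈N ∷ []) _ =
      subst (_∈C C) (sym (∪-identityʳ δ)) (proj₁ building δ (All.lookup N⊆B δ∈N))
    union-∈C L@(_ ∷ _ ∷ _) uL L⊆N incomparable =
      proj₁ (antichain L (uL , s≤s (s≤s z≤n) , L⊆N , incomparable))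

  maximal-of-same-union : ∀ {N N' β} → Nested N → Nested N' → ⋃ N ≡ ⋃ N' → β ∈ₗ maximals N → β ∈ₗ maximals N'
  maximal-of-same-union {N} {N'} {β} nN nN' ⋃N≡⋃N' β∈max
    with β∈N , βmax ← ∈-filter⁻ (isMaximal? N) β∈max
    with δ' , δ'∈N' , β⊆δ' ← covered⇒below-member nN' (proj₁ nN') id (All.lookup (proj₁ (proj₂ nN)) β∈N)
                                (subst (β ⊆_) ⋃N≡⋃N' (⋃⁺ β∈N))
    with μ , μ∈max' , δ'⊆μ ← maximal-above N' δ'∈N'
    with μ∈N' , _ ← ∈-filter⁻ (isMaximal? N') μ∈max'
    with δ , δ∈N , μ⊆δ ← covered⇒below-member nN (proj₁ nN) id (All.lookup (proj₁ (proj₂ nN')) μ∈N')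
                            (subst (μ ⊆_) (sym ⋃N≡⋃N') (⋃⁺ μ∈N'))
    with refl ← All.lookup βmax δ∈N (⊆-trans β⊆δ' (⊆-trans δ'⊆μ μ⊆δ))
    = subst (_∈ₗ maximals N') (⊆-antisym μ⊆δ (⊆-trans β⊆δ' δ'⊆μ)) μ∈max'

module RealProperties (R : Reals) where
  open Reals R
  open ≡-Reasoning

  +-identityʳ : ∀ x → x + 0# ≡ x
  +-identityʳ x = trans (+-comm x 0#) (+-identityˡ x)

  +-cancelˡ : ∀ a {x y} → a + x ≡ a + y → x ≡ y
  +-cancelˡ a {x} {y} a+x≡a+y = begin
    x               ≡⟨ sym (+-identityˡ x) ⟩
    0# + x          ≡⟨ cong (_+ x) (sym (+-inverseˡ a)) ⟩
    (- a) + a + x   ≡⟨ +-assoc (- a) a x ⟩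
    - a + (a + x)   ≡⟨ cong (- a +_) a+x≡a+y ⟩
    - a + (a + y)   ≡⟨ sym (+-assoc (- a) a y) ⟩
    (- a) + a + y   ≡⟨ cong (_+ y) (+-inverseˡ a) ⟩
    0# + y          ≡⟨ +-identityˡ y ⟩
    y               ∎

  *-zeroʳ : ∀ x → x * 0# ≡ 0#
  *-zeroʳ x = sym (+-cancelˡ (x * 0#) (begin
    x * 0# + 0#       ≡⟨ +-identityʳ _ ⟩
    x * 0#            ≡⟨ cong (x *_) (sym (+-identityˡ 0#)) ⟩
    x * (0# + 0#)     ≡⟨ distribˡ x 0# 0# ⟩
    x * 0# + x * 0#   ∎))

  *-identityʳ : ∀ x → x * 1# ≡ x
  *-identityʳ x = trans (*-comm x 1#) (*-identityˡ x)

  x>0⇒x≢0 : ∀ {x} → 0# < x → x ≢ 0#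
  x>0⇒x≢0 0<x refl = <-irrefl 0# 0<x

  +-pos-nonneg : ∀ {x y} → 0# < x → 0# ≤ y → 0# < x + y
  +-pos-nonneg {x} 0<x (inj₂ refl) = subst (0# <_) (sym (+-identityʳ x)) 0<x
  +-pos-nonneg {x} {y} 0<x (inj₁ 0<y) =
    <-trans _ _ _ 0<y (subst (_< x + y) (+-identityˡ y) (+-mono-< 0# x y 0<x))

  +-nonneg-pos : ∀ {x y} → 0# ≤ x → 0# < y → 0# < x + y
  +-nonneg-pos {x} {y} 0≤x 0<y = subst (0# <_) (+-comm y x) (+-pos-nonneg 0<y 0≤x)

  +-nonneg : ∀ {x y} → 0# ≤ x → 0# ≤ y → 0# ≤ x + y
  +-nonneg (inj₁ 0<x) 0≤y = inj₁ (+-pos-nonneg 0<x 0≤y)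
  +-nonneg {y = y} (inj₂ refl) 0≤y = subst (0# ≤_) (sym (+-identityˡ y)) 0≤y

  +-nonneg-antisym : ∀ {x y r s} → 0# ≤ r → 0# ≤ s → x + r ≡ y → y + s ≡ x → x ≡ y
  +-nonneg-antisym {x} {y} {r} {s} 0≤r 0≤s x+r≡y y+s≡x = begin
    x       ≡⟨ sym (+-identityʳ x) ⟩
    x + 0#  ≡⟨ cong (x +_) (sym r≡0) ⟩
    x + r   ≡⟨ x+r≡y ⟩
    y       ∎
    where
    r+s≡0 : r + s ≡ 0#
    r+s≡0 = +-cancelˡ x (begin
      x + (r + s)  ≡⟨ sym (+-assoc x r s) ⟩
      x + r + s    ≡⟨ cong (_+ s) x+r≡y ⟩
      y + s        ≡⟨ y+s≡x ⟩
      x            ≡⟨ sym (+-identityʳ x) ⟩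
      x + 0#       ∎)
    r≡0 : r ≡ 0#
    r≡0 = [ (λ 0<r → contradiction r+s≡0 (x>0⇒x≢0 (+-pos-nonneg 0<r 0≤s))) , sym ]′ 0≤r

lookup-σX-∈ : ∀ {d} {β : Subset d} {i} → i ∈ β → lookup (σX β) i ≡ 1
lookup-σX-∈ Vec.here = refl
lookup-σX-∈ (Vec.there i∈β) = lookup-σX-∈ i∈β

lookup-σX-∉ : ∀ {d} {β : Subset d} i → i ∉ β → lookup (σX β) i ≡ 0
lookup-σX-∉ {β = true ∷ β} zero i∉β = contradiction Vec.here i∉β
lookup-σX-∉ {β = false ∷ β} zero _ = refl
lookup-σX-∉ {β = _ ∷ β} (suc i) i∉β = lookup-σX-∉ i (i∉β ∘ Vec.there)

-- The second with-expression exposes the test i ≟ j hidden inside ιX, so that the with abstracts over it.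
lookup-ιX-≡ : ∀ {d} (i : Fin d) → lookup (ιX i) i ≡ 1
lookup-ιX-≡ i with i ≟ᶠ i | trans (sym (Vecₚ.lookup∘tabulate _ i)) (refl {x = lookup (ιX i) i})
... | yes _ | 1≡lookup = sym 1≡lookup
... | no i≢i | _ = contradiction refl i≢i

lookup-ιX-≢ : ∀ {d} {x i : Fin d} → x ≢ i → lookup (ιX x) i ≡ 0
lookup-ιX-≢ {x = x} {i} x≢i with x ≟ᶠ i | trans (sym (Vecₚ.lookup∘tabulate _ i)) (refl {x = lookup (ιX x) i})
... | yes x≡i | _ = contradiction x≡i x≢i
... | no _ | 0≡lookup = sym 0≡lookup

module Realization (R : Reals) where
  open Reals R
  open Geometry R
  open RealProperties R
  open ≡-Reasoning

  lincomb-map : ∀ {V W : Set} {d} (f : W → Vecℝ d) (k : W → ℝ) (g : V → W) xs →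
                lincomb f k (map g xs) ≈ lincomb (f ∘ g) (k ∘ g) xs
  lincomb-map f k g [] i = refl
  lincomb-map f k g (x ∷ xs) i = cong (k (g x) * f (g x) i +_) (lincomb-map f k g xs i)

  lincomb-↭ : ∀ {V : Set} {d} (f : V → Vecℝ d) (k : V → ℝ) {xs ys} → xs ↭ ys →
              lincomb f k xs ≈ lincomb f k ys
  lincomb-↭ f k _↭_.refl i = refl
  lincomb-↭ f k (_↭_.prep x p) i = cong (k x * f x i +_) (lincomb-↭ f k p i)
  lincomb-↭ f k (_↭_.swap {xs = xs} {ys = ys} x y p) i = begin
    a + (b + lincomb f k xs i)  ≡⟨ sym (+-assoc a b _) ⟩
    a + b + lincomb f k xs i    ≡⟨ cong₂ _+_ (+-comm a b) (lincomb-↭ f k p i) ⟩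
    b + a + lincomb f k ys i    ≡⟨ +-assoc b a _ ⟩
    b + (a + lincomb f k ys i)  ∎
    where
    a = k x * f x i
    b = k y * f y i
  lincomb-↭ f k (_↭_.trans p q) i = trans (lincomb-↭ f k p i) (lincomb-↭ f k q i)

  faithful-map : ∀ {V W : Set} {d} {f : W → Vecℝ d} {D : List V → Set} (g : V → W) →
                 FaithfullyRealizes (f ∘ g) D →
                 FaithfullyRealizes f (λ γ → Σ (List V) (λ N → D N × γ ≡ map g N))
  faithful-map {f = f} g faithful ._ ._ uα uβ (N , DN , refl) (N' , DN' , refl) k l k>0 l>0 eq
    with same , k≡l ← faithful N N' (Uniqueₚ.map⁻ uα) (Uniqueₚ.map⁻ uβ) DN DN' (k ∘ g) (l ∘ g)
                        (Allₚ.map⁻ k>0) (Allₚ.map⁻ l>0)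
                        (λ i → trans (sym (lincomb-map f k g N i)) (trans (eq i) (lincomb-map f l g N' i)))
    = (λ v → mk⇔ (image-⊆ (Equivalence.to ∘ same)) (image-⊆ (Equivalence.from ∘ same))) , Allₚ.map⁺ k≡l
    where
    image-⊆ : ∀ {M M'} → (∀ x → x ∈ₗ M → x ∈ₗ M') → ∀ {v} → v ∈ₗ map g M → v ∈ₗ map g M'
    image-⊆ M⊆M' v∈gM with x , x∈M , refl ← ∈-map⁻ g v∈gM = ∈-map⁺ g (M⊆M' x x∈M)

  *-fromℕ-1 : ∀ x → x * fromℕ 1 ≡ x
  *-fromℕ-1 x = trans (cong (x *_) (+-identityʳ 1#)) (*-identityʳ x)

  lincomb-unit-∉ : ∀ {d} (k : Fin d → ℝ) α {i} → i ∉ₗ α → lincomb (κX ∘ ιX) k α i ≡ 0#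
  lincomb-unit-∉ k [] i∉α = refl
  lincomb-unit-∉ k (a ∷ α) {i} i∉α = begin
    k a * fromℕ (lookup (ιX a) i) + lincomb (κX ∘ ιX) k α i
      ≡⟨ cong₂ (λ n s → k a * fromℕ n + s) (lookup-ιX-≢ (λ a≡i → i∉α (here (sym a≡i))))
                                            (lincomb-unit-∉ k α (i∉α ∘ there)) ⟩
    k a * 0# + 0#
      ≡⟨ trans (+-identityʳ _) (*-zeroʳ (k a)) ⟩
    0# ∎

  lincomb-unit-∈ : ∀ {d} (k : Fin d → ℝ) {α i} → Unique α → i ∈ₗ α → lincomb (κX ∘ ιX) k α i ≡ k i
  lincomb-unit-∈ k {i ∷ α} (i∉α ∷ _) (here refl) = begin
    k i * fromℕ (lookup (ιX i) i) + lincomb (κX ∘ ιX) k α i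
      ≡⟨ cong₂ (λ n s → k i * fromℕ n + s) (lookup-ιX-≡ i)
                                            (lincomb-unit-∉ k α (λ i∈α → All.lookup i∉α i∈α refl)) ⟩
    k i * fromℕ 1 + 0#
      ≡⟨ trans (+-identityʳ _) (*-fromℕ-1 (k i)) ⟩
    k i ∎
  lincomb-unit-∈ k {a ∷ α} {i} (a∉α ∷ uα) (there i∈α) = begin
    k a * fromℕ (lookup (ιX a) i) + lincomb (κX ∘ ιX) k α i
      ≡⟨ cong₂ (λ n s → k a * fromℕ n + s) (lookup-ιX-≢ (All.lookup a∉α i∈α)) (lincomb-unit-∈ k uα i∈α) ⟩
    k a * 0# + k i
      ≡⟨ trans (cong (_+ k i) (*-zeroʳ (k a))) (+-identityˡ (k i)) ⟩
    k i ∎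

  unit-expansion : ∀ {d} (v : Vecℝ d) {α} → Unique α → (∀ i → i ∉ₗ α → v i ≡ 0#) →
                   v ≈ lincomb (κX ∘ ιX) v α
  unit-expansion v {α} uα vanishes i with DecMembership._∈?_ _≟ᶠ_ i α
  ... | yes i∈α = sym (lincomb-unit-∈ v uα i∈α)
  ... | no i∉α = trans (vanishes i i∉α) (sym (lincomb-unit-∉ v α i∉α))

  unit-faithful : ∀ {d} (D : List (Fin d) → Set) → FaithfullyRealizes (κX ∘ ιX) D
  unit-faithful D α β uα uβ _ _ k l k>0 l>0 eq =
    (λ v → mk⇔ (support-⊆ uα uβ k>0 eq) (support-⊆ uβ uα l>0 (sym ∘ eq))) ,
    All.tabulate (λ a∈α → trans (sym (lincomb-unit-∈ k uα a∈α))
                                (trans (eq _) (lincomb-unit-∈ l uβ (support-⊆ uα uβ k>0 eq a∈α))))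
    where
    support-⊆ : ∀ {α β k l} → Unique α → Unique β → All (λ a → 0# < k a) α →
                lincomb (κX ∘ ιX) k α ≈ lincomb (κX ∘ ιX) l β → ∀ {v} → v ∈ₗ α → v ∈ₗ β
    support-⊆ {α} {β} {k} {l} uα uβ k>0 eq {v} v∈α with DecMembership._∈?_ _≟ᶠ_ v β
    ... | yes v∈β = v∈β
    ... | no v∉β =
      contradiction (trans (sym (lincomb-unit-∈ k uα v∈α)) (trans (eq v) (lincomb-unit-∉ l β v∉β)))
                    (x>0⇒x≢0 (All.lookup k>0 v∈α))

  module _ {d : ℕ} where

    term-∈ : ∀ (c : ℝ) {β : Subset d} {i} → i ∈ β → c * κX (σX β) i ≡ c
    term-∈ c i∈β = trans (cong (λ n → c * fromℕ n) (lookup-σX-∈ i∈β)) (*-fromℕ-1 c)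

    term-∉ : ∀ (c : ℝ) {β : Subset d} {i} → i ∉ β → c * κX (σX β) i ≡ 0#
    term-∉ c {i = i} i∉β = trans (cong (λ n → c * fromℕ n) (lookup-σX-∉ i i∉β)) (*-zeroʳ c)

    term-nonneg : ∀ {c : ℝ} (β : Subset d) i → 0# ≤ c → 0# ≤ c * κX (σX β) i
    term-nonneg {c} β i 0≤c with i ∈? β
    ... | yes i∈β = subst (0# ≤_) (sym (term-∈ c i∈β)) 0≤c
    ... | no i∉β = inj₂ (sym (term-∉ c i∉β))

    lincomb-σ-∉ : ∀ (k : Subset d → ℝ) N {i} → i ∉ ⋃ N → lincomb (κX ∘ σX) k N i ≡ 0#
    lincomb-σ-∉ k [] i∉⋃N = refl
    lincomb-σ-∉ k (β ∷ N) i∉⋃N =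
      trans (cong₂ _+_ (term-∉ (k β) (i∉⋃N ∘ x∈p∪q⁺ ∘ inj₁)) (lincomb-σ-∉ k N (i∉⋃N ∘ x∈p∪q⁺ ∘ inj₂)))
            (+-identityˡ 0#)

    lincomb-σ-nonneg : ∀ {k : Subset d → ℝ} {N} i → All (λ β → 0# ≤ k β) N →
                       0# ≤ lincomb (κX ∘ σX) k N i
    lincomb-σ-nonneg i [] = inj₂ refl
    lincomb-σ-nonneg {N = β ∷ N} i (0≤kβ ∷ 0≤k) = +-nonneg (term-nonneg β i 0≤kβ) (lincomb-σ-nonneg i 0≤k)

    lincomb-σ-pos : ∀ {k : Subset d → ℝ} {N i} → All (λ β → 0# < k β) N → i ∈ ⋃ N →
                    0# < lincomb (κX ∘ σX) k N i
    lincomb-σ-pos [] i∈⊥ = contradiction i∈⊥ ∉⊥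
    lincomb-σ-pos {k} {β ∷ N} {i} (0<kβ ∷ 0<k) i∈⋃N with x∈p∪q⁻ β (⋃ N) i∈⋃N
    ... | inj₁ i∈β =
      +-pos-nonneg (subst (0# <_) (sym (term-∈ (k β) i∈β)) 0<kβ) (lincomb-σ-nonneg i (All.map inj₁ 0<k))
    ... | inj₂ i∈⋃N' = +-nonneg-pos (term-nonneg β i (inj₁ 0<kβ)) (lincomb-σ-pos 0<k i∈⋃N')

    lincomb-σ-support : ∀ {k l : Subset d → ℝ} {N N'} → All (λ β → 0# < k β) N →
                        lincomb (κX ∘ σX) k N ≈ lincomb (κX ∘ σX) l N' → ⋃ N ⊆ ⋃ N'
    lincomb-σ-support {k} {l} {N} {N'} k>0 eq {i} i∈⋃N with i ∈? ⋃ N'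
    ... | yes i∈⋃N' = i∈⋃N'
    ... | no i∉⋃N' =
      contradiction (trans (eq i) (lincomb-σ-∉ l N' i∉⋃N')) (x>0⇒x≢0 (lincomb-σ-pos k>0 i∈⋃N))

    lincomb-σ-same-support : ∀ {k l : Subset d → ℝ} {N N'} →
                             All (λ β → 0# < k β) N → All (λ β → 0# < l β) N' →
                             lincomb (κX ∘ σX) k N ≈ lincomb (κX ∘ σX) l N' → ⋃ N ≡ ⋃ N'
    lincomb-σ-same-support {N = N} {N'} k>0 l>0 eq =
      ⊆-antisym (lincomb-σ-support {N = N} {N'} k>0 eq) (lincomb-σ-support {N = N'} {N} l>0 (sym ∘ eq))

module NestedRealization (R : Reals) {d : ℕ} (C : SimplicialComplex d) (B : Subset d → Set)
                         (building : IsBuildingSet C B) where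
  open Reals R
  open Geometry R
  open RealProperties R
  open Realization R
  open NestedSets C B building
  open ≡-Reasoning

  Positive : (Subset d → ℝ) → List (Subset d) → Set
  Positive k = All (λ β → 0# < k β)

  Agree : (k l : Subset d → ℝ) → List (Subset d) → List (Subset d) → Set
  Agree k l N N' = (∀ β → β ∈ₗ N ⇔ β ∈ₗ N') × All (λ β → k β ≡ l β) N

  agree-∷ : ∀ {k l β N N'} → k β ≡ l β → Agree k l N N' → Agree k l (β ∷ N) (β ∷ N')
  agree-∷ kβ≡lβ (same , k≡l) =
    (λ δ → mk⇔ (cons (Equivalence.to (same δ))) (cons (Equivalence.from (same δ)))) , kβ≡lβ ∷ k≡l
    where
    cons : ∀ {δ β M M'} → (δ ∈ₗ M → δ ∈ₗ M') → δ ∈ₗ β ∷ M → δ ∈ₗ β ∷ M'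
    cons _ (here δ≡β) = here δ≡β
    cons M⊆M' (there δ∈M) = there (M⊆M' δ∈M)

  agree-↭ : ∀ {k l N N' M M'} → N ↭ M → N' ↭ M' → Agree k l M M' → Agree k l N N'
  agree-↭ N↭M N'↭M' (same , k≡l) =
    (λ δ → mk⇔ (∈-resp-↭ (↭-sym N'↭M') ∘ Equivalence.to (same δ) ∘ ∈-resp-↭ N↭M)
               (∈-resp-↭ (↭-sym N↭M) ∘ Equivalence.from (same δ) ∘ ∈-resp-↭ N'↭M')) ,
    All-resp-↭ (↭-sym N↭M) k≡l

  coefficient-at-private-point : ∀ {k l : Subset d → ℝ} {β N N' y} → y ∈ β → y ∉ ⋃ N →
    lincomb (κX ∘ σX) k (β ∷ N) ≈ lincomb (κX ∘ σX) l (β ∷ N') → l β + lincomb (κX ∘ σX) l N' y ≡ k β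
  coefficient-at-private-point {k} {l} {β} {N} {N'} {y} y∈β y∉⋃N eq = begin
    l β + lincomb (κX ∘ σX) l N' y
      ≡⟨ cong (_+ lincomb (κX ∘ σX) l N' y) (sym (term-∈ (l β) y∈β)) ⟩
    lincomb (κX ∘ σX) l (β ∷ N') y
      ≡⟨ sym (eq y) ⟩
    k β * κX (σX β) y + lincomb (κX ∘ σX) k N y
      ≡⟨ cong₂ _+_ (term-∈ (k β) y∈β) (lincomb-σ-∉ k N y∉⋃N) ⟩
    k β + 0#
      ≡⟨ +-identityʳ (k β) ⟩
    k β ∎

  peel-maximal : ∀ {k l β N N'} → Nested (β ∷ N) → Nested (β ∷ N') → IsMaximal N β → IsMaximal N' β →
                 Positive k N → Positive l N' →
                 lincomb (κX ∘ σX) k (β ∷ N) ≈ lincomb (κX ∘ σX) l (β ∷ N') →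
                 k β ≡ l β × lincomb (κX ∘ σX) k N ≈ lincomb (κX ∘ σX) l N'
  peel-maximal {k} {l} {β} {N} {N'} nN nN' βmax βmax' k>0 l>0 eq
    with y , y∈β , y∉⋃N ← private-point nN βmax
    with y' , y'∈β , y'∉⋃N' ← private-point nN' βmax'
    = kβ≡lβ ,
      λ i → +-cancelˡ (l β * κX (σX β) i) (trans (cong (λ c → c * κX (σX β) i + _) (sym kβ≡lβ)) (eq i))
    where
    kβ≡lβ : k β ≡ l β
    kβ≡lβ = +-nonneg-antisym (lincomb-σ-nonneg y' (All.map inj₁ k>0)) (lincomb-σ-nonneg y (All.map inj₁ l>0))
              (coefficient-at-private-point {N = N'} {N' = N} y'∈β y'∉⋃N' (sym ∘ eq))
              (coefficient-at-private-point {N = N} {N' = N'} y∈β y∉⋃N eq)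

  nested-tail : ∀ {β N} → Nested (β ∷ N) → Nested N
  nested-tail nβN@(_ ∷ uN , _) = nested-⊆ nβN uN there

  nested-agree : ∀ n {N N'} → length N ≡ n → Nested N → Nested N' → ∀ {k l} → Positive k N → Positive l N' →
                 lincomb (κX ∘ σX) k N ≈ lincomb (κX ∘ σX) l N' → Agree k l N N'

  agree-front : ∀ n {β N N'} → length N ≡ n → Nested (β ∷ N) → Nested (β ∷ N') →
                IsMaximal N β → IsMaximal N' β → ∀ {k l} → Positive k (β ∷ N) → Positive l (β ∷ N') →
                lincomb (κX ∘ σX) k (β ∷ N) ≈ lincomb (κX ∘ σX) l (β ∷ N') → Agree k l (β ∷ N) (β ∷ N')
  agree-front n |N|≡n nβN nβN' βmax βmax' (_ ∷ k>0) (_ ∷ l>0) eq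
    with kβ≡lβ , eq₀ ← peel-maximal nβN nβN' βmax βmax' k>0 l>0 eq
    = agree-∷ kβ≡lβ (nested-agree n |N|≡n (nested-tail nβN) (nested-tail nβN') k>0 l>0 eq₀)

  nested-agree _ {[]} {[]} _ _ _ _ _ _ = (λ _ → mk⇔ id id) , []
  nested-agree _ {[]} {N'@(δ ∷ _)} _ _ (_ , Bδ ∷ _ , _) {k} _ l>0 eq
    with x , x∈δ ← building-nonempty Bδ
    = contradiction (lincomb-σ-support {l = k} {N = N'} {[]} l>0 (sym ∘ eq) (⋃⁺ {L = N'} (here refl) x∈δ))
                    ∉⊥
  nested-agree (suc n) {N@(γ ∷ _)} {N'} |N|≡1+n nN nN' {k} {l} k>0 l>0 eq
    with β , β∈max , _ ← maximal-above N (here refl)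
    with β∈N' , βmax' ← ∈-filter⁻ (isMaximal? N') 
                     (maximal-of-same-union nN nN' (lincomb-σ-same-support {N = N} {N'} k>0 l>0 eq) β∈max)
    with β∈N , βmax ← ∈-filter⁻ (isMaximal? N) β∈max
    with N₀ , N↭ ← ∈⇒↭∷ β∈N
    with N₀' , N'↭ ← ∈⇒↭∷ β∈N'
    = agree-↭ N↭ N'↭
        (agree-front n (suc-injective (trans (sym (↭-length N↭)) |N|≡1+n))
          (nested-↭ N↭ nN) (nested-↭ N'↭ nN')
          (All.tail (All-resp-↭ N↭ βmax)) (All.tail (All-resp-↭ N'↭ βmax'))
          (All-resp-↭ N↭ k>0) (All-resp-↭ N'↭ l>0)
          (λ i → trans (sym (lincomb-↭ _ k N↭ i)) (trans (eq i) (lincomb-↭ _ l N'↭ i))))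

  nested-faithful : FaithfullyRealizes (κX ∘ σX) Nested
  nested-faithful N N' _ _ nN nN' k l k>0 l>0 eq = nested-agree _ refl nN nN' k>0 l>0 eq

  nested-cone-⊆-face : ∀ v → InUnionImage κX (InSt C B) v → InUnionImage (κX ∘ ιX) (InCList C) v
  nested-cone-⊆-face v (_ , _ , (N , nN , refl) , k , k≥0 , v≈) =
    support , unique-support , Any.map support-⊆ (⋃-nested-∈C nN) ,
    v , All.tabulate (λ {i} _ → v-nonneg i) , unit-expansion v unique-support vanishes
    where
    support : List (Fin d)
    support = filter (_∈? ⋃ N) (allFin d)
    unique-support : Unique support
    unique-support = Uniqueₚ.filter⁺ (_∈? ⋃ N) (Uniqueₚ.allFin⁺ d)
    support-⊆ : ∀ {α} → ⋃ N ⊆ α → All (_∈ α) support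
    support-⊆ ⋃N⊆α = All.tabulate (⋃N⊆α ∘ proj₂ ∘ ∈-filter⁻ (_∈? ⋃ N) {xs = allFin d})
    v≈σ : v ≈ lincomb (κX ∘ σX) (k ∘ σX) N
    v≈σ i = trans (v≈ i) (lincomb-map κX k σX N i)
    v-nonneg : ∀ i → 0# ≤ v i
    v-nonneg i = subst (0# ≤_) (sym (v≈σ i)) (lincomb-σ-nonneg i (Allₚ.map⁻ k≥0))
    vanishes : ∀ i → i ∉ₗ support → v i ≡ 0#
    vanishes i i∉support =
      trans (v≈σ i) (lincomb-σ-∉ (k ∘ σX) N (i∉support ∘ ∈-filter⁺ (_∈? ⋃ N) (∈-allFin i)))

lemma6p3 : (R : Reals) → (n : ℕ) → (C : SimplicialComplex (suc n)) → CoversX C →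
           (B : Subset (suc n) → Set) → IsBuildingSet C B →
           let open Geometry R in
             FaithfullyRealizes (κX ∘ ιX) (InCList C)
           × FaithfullyRealizes κX (InSt C B)
           × (∀ v → InUnionImage κX (InSt C B) v → InUnionImage (κX ∘ ιX) (InCList C) v)
lemma6p3 R n C _ B building = unit-faithful (InCList C) , faithful-map σX nested-faithful , nested-cone-⊆-face
  where
  open Realization R
  open NestedRealization R C B building
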